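{- There is an absolute constant $c>0$ such that the following holds. Let $G$ be a finite cyclic group of order $n\ge 2$ with generator $\gamma$, let $d:G\to G$ be the univariate Diffie-Hellman mapping $d(\gamma^a)=\gamma^{a^2}$, $a=0,\ldots,n-1$, and let $f$ be any cyclotomic mapping of index $\ell$ of $G$ (for any positive divisor $\ell$ of $n$). Then the number of $x\in G$ with $f(x)=d(x)$ is at most $c\,\ell\, n^{1/2}$. Moreover, if $n$ is prime, this number is at most $2\ell$.
   Context: For a positive divisor $\ell$ of $n$, let $C_{\ell,0}=\{\gamma^{j\ell}: j=0,1,\ldots,n/\ell-1\}$ and $C_{\ell,i}=\gamma^i C_{\ell,0}$ for $i=0,1,\ldots,\ell-1$. A cyclotomic mapping of index $\ell$ of $G$ is a map $f:G\to G$ for which there exist a positive integer $r$ and $a_0,\ldots,a_{\ell-1}\in G$ with $f(x)=a_i x^r$ whenever $x\in C_{\ell,i}$, $i=0,\ldots,\ell-1$. -}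

module Defs where

open import Level using (0ℓ)
open import Algebra.Bundles using (Group)
open import Data.Nat using (ℕ; zero; suc; _*_; _<_; _/_; NonZero)
open import Data.Fin using (Fin; toℕ)
open import Data.Product using (Σ; ∃; _×_)
open import Relation.Nullary using (Dec; yes; no)
open import Relation.Binary.PropositionalEquality using (_≡_)
open import Relation.Binary using (Decidable)

module _ (G : Group 0ℓ 0ℓ) where
  open Group G

  pow : Carrier → ℕ → Carrier
  pow x zero = ε
  pow x (suc k) = x ∙ pow x k

  IsCyclicOfOrder : Carrier → ℕ → Set
  IsCyclicOfOrder γ n =
    (∀ x → Σ (Fin n) λ a → x ≈ pow γ (toℕ a)) ×
    (∀ (a b : Fin n) → pow γ (toℕ a) ≈ pow γ (toℕ b) → a ≡ b)

  InCoset : (γ : Carrier) (n ℓ : ℕ) .{{_ : NonZero ℓ}} → ℕ → Carrier → Set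
  InCoset γ n ℓ i x = Σ ℕ λ j → (j < n / ℓ) × (x ≈ pow γ i ∙ pow γ (j * ℓ))

  IsCyclotomic : (γ : Carrier) (n ℓ : ℕ) .{{_ : NonZero ℓ}} → (Carrier → Carrier) → Set
  IsCyclotomic γ n ℓ f =
    Σ ℕ λ r → (0 < r) × Σ (Fin ℓ → Carrier) λ a →
      ∀ (i : Fin ℓ) (x : Carrier) → InCoset γ n ℓ (toℕ i) x → f x ≈ a i ∙ pow x r

  -- the Diffie–Hellman map evaluated at γ^a is γ^(a²); count of x = γ^a (a = 0,…,n-1)
  -- with f(x) = d(x).  Since a ↦ γ^a is a bijection Fin n → G, this counts x ∈ G.
  countDH : (_≈?_ : Decidable _≈_) (γ : Carrier) (n : ℕ) → (Carrier → Carrier) → ℕ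
  countDH _≈?_ γ n f = go n
    where
    go : ℕ → ℕ
    go zero = zero
    go (suc k) with f (pow γ k) ≈? pow γ (k * k)
    ... | yes _ = suc (go k)
    ... | no _ = go k

{-# OPTIONS --safe #-}
-- Write x = γ^a.  On the coset C_{ℓ,i} the equation f(x) = d(x) reads γ^(a²) = a_i γ^(a r), i.e.
-- a² + B a + C_i ≡ 0 (mod n) with B = (n − 1) r and C_i = (n − 1) log a_i; so there are at most
-- ℓ · R solutions, where R bounds the number of roots modulo n of a monic quadratic.  This root
-- count is submultiplicative on coprime moduli (Chinese remainder theorem).  Modulo p^e, fix a
-- root x0 and put w = 2 x0 + B: every root x has p^e ∣ (x − x0)(x + x0 + B), and the two factors
-- differ by ± w.  With u maximal such that 2u ≤ e and p^u ∣ w, one of the factors is divisible by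
-- p^(e − u), so the roots lie in two residue classes modulo p^(e − u): at most 2 p^u ≤ 2 p^(e/2)
-- roots, at most p^(e/2) when 2u = e, hence squared at most p^e once p ≥ 5.  Treating 2 and 3
-- separately gives R² ≤ 16 n in general, and R ≤ 2 when n is prime.
module Submission where

open import Level using (0ℓ)
open import Function using (id; it)
open import Algebra.Bundles using (Group)
open import Data.Nat
open import Data.Nat.Properties
open import Algebra.Properties.CommutativeSemigroup +-commutativeSemigroup using (interchange; xy∙z≈xz∙y)
open import Data.Nat.DivMod
open import Data.Nat.Divisibility
open import Data.Nat.Induction using (<-wellFounded)
open import Data.Nat.ListAction using (product)
open import Data.Nat.Primality using (Prime; euclidsLemma; prime⇒nonZero; prime⇒nonTrivial; prime[2]; ¬prime[0]; ¬prime[1]; prime?)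
open import Data.Nat.Primality.Factorisation using (factorise)
open import Data.Nat.Tactic.RingSolver using (solve-∀)
open import Data.Fin using (Fin; toℕ; fromℕ<)
open import Data.Fin.Properties using (toℕ<n; toℕ-fromℕ<)
open import Data.List using ([]; _∷_)
open import Data.List.Relation.Unary.All using (_∷_)
open import Data.Product using (Σ; ∃; _×_; _,_; proj₁; proj₂)
open import Data.Sum using (_⊎_; inj₁; inj₂; [_,_]′)
open import Data.Unit using (⊤; tt)
open import Induction.WellFounded using (Acc; acc)
open import Relation.Nullary using (Dec; yes; no; ¬_; contradiction)
open import Relation.Nullary.Decidable using (_×-dec_; from-yes)
open import Relation.Unary using (Pred)
import Relation.Unary as U
open import Relation.Unary.Properties using (_∩?_; ∁?)
open import Relation.Binary using (Decidable)
open import Relation.Binary.PropositionalEquality using (_≡_; _≢_; refl; sym; trans; cong; cong₂; subst; module ≡-Reasoning)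
open import Defs

-- Counting in initial segments of ℕ

indicator : {A : Set} → Dec A → ℕ
indicator (yes _) = 1
indicator (no _) = 0

indicator-mono : {A B : Set} (a? : Dec A) (b? : Dec B) → (A → B) → indicator a? ≤ indicator b?
indicator-mono (yes _) (yes _) _ = ≤-refl
indicator-mono (yes a) (no ¬b) f = contradiction (f a) ¬b
indicator-mono (no _) _ _ = z≤n

indicator-× : {A B : Set} (a? : Dec A) (b? : Dec B) → indicator (a? ×-dec b?) ≡ indicator a? * indicator b?
indicator-× (yes _) (yes _) = refl
indicator-× (yes _) (no _) = refl
indicator-× (no _) _ = refl

indicator-⊎ : {A B C : Set} (a? : Dec A) (b? : Dec B) (c? : Dec C) → (A → B ⊎ C) →
              indicator a? ≤ indicator b? + indicator c?
indicator-⊎ (no _) _ _ _ = z≤n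
indicator-⊎ (yes _) (yes _) _ _ = s≤s z≤n
indicator-⊎ (yes _) (no _) (yes _) _ = ≤-refl
indicator-⊎ (yes a) (no ¬b) (no ¬c) f with f a
... | inj₁ b = contradiction b ¬b
... | inj₂ c = contradiction c ¬c

count : {P : Pred ℕ 0ℓ} → U.Decidable P → ℕ → ℕ
count P? zero = 0
count P? (suc n) = count P? n + indicator (P? n)

module _ {P Q : Pred ℕ 0ℓ} (P? : U.Decidable P) (Q? : U.Decidable Q) where

  count-mono : ∀ n → (∀ x → x < n → P x → Q x) → count P? n ≤ count Q? n
  count-mono zero _ = z≤n
  count-mono (suc n) P⊆Q = +-mono-≤ (count-mono n λ x x<n → P⊆Q x (m<n⇒m<1+n x<n))
                                    (indicator-mono (P? n) (Q? n) (P⊆Q n ≤-refl))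

  count-∪ : {R : Pred ℕ 0ℓ} (R? : U.Decidable R) → ∀ n → (∀ x → x < n → P x → Q x ⊎ R x) →
            count P? n ≤ count Q? n + count R? n
  count-∪ R? zero _ = z≤n
  count-∪ R? (suc n) P⊆Q∪R = begin
    count P? n + indicator (P? n)
      ≤⟨ +-mono-≤ (count-∪ R? n λ x x<n → P⊆Q∪R x (m<n⇒m<1+n x<n))
                  (indicator-⊎ (P? n) (Q? n) (R? n) (P⊆Q∪R n ≤-refl)) ⟩
    (count Q? n + count R? n) + (indicator (Q? n) + indicator (R? n))
      ≡⟨ interchange (count Q? n) (count R? n) _ _ ⟩
    count Q? (suc n) + count R? (suc n) ∎
    where open ≤-Reasoning

count-all : ∀ n → count {λ _ → ⊤} (λ _ → yes tt) n ≡ n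
count-all zero = refl
count-all (suc n) = trans (cong (_+ 1) (count-all n)) (+-comm n 1)

count≤n : {P : Pred ℕ 0ℓ} (P? : U.Decidable P) → ∀ n → count P? n ≤ n
count≤n P? n = subst (count P? n ≤_) (count-all n) (count-mono P? (λ _ → yes tt) n λ _ _ _ → tt)

count-witness : {P : Pred ℕ 0ℓ} (P? : U.Decidable P) → ∀ n → 0 < count P? n → ∃ λ x → x < n × P x
count-witness P? (suc n) pos with P? n
... | yes p = n , ≤-refl , p
... | no _ with count-witness P? n (subst (0 <_) (+-identityʳ _) pos)
...   | x , x<n , px = x , m<n⇒m<1+n x<n , px

count-cong : {P Q : Pred ℕ 0ℓ} (P? : U.Decidable P) (Q? : U.Decidable Q) → ∀ n →
             (∀ x → x < n → P x → Q x) → (∀ x → x < n → Q x → P x) → count P? n ≡ count Q? n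
count-cong P? Q? n P⊆Q Q⊆P = ≤-antisym (count-mono P? Q? n P⊆Q) (count-mono Q? P? n Q⊆P)

count-remove : {Q : Pred ℕ 0ℓ} (Q? : U.Decidable Q) → ∀ {y} n → y < n → Q y →
               count Q? n ≡ suc (count (Q? ∩? ∁? (_≟ y)) n)
count-remove Q? {y} (suc n) y<1+n qy with y ≟ n
... | yes refl with Q? y | y ≟ y
...   | no ¬qy | _ = contradiction qy ¬qy
...   | yes _ | no y≢y = contradiction refl y≢y
...   | yes _ | yes _ = trans (+-comm _ 1) (cong suc (trans
        (count-cong Q? (Q? ∩? ∁? (_≟ y)) y (λ x x<y qx → qx , λ x≡y → <-irrefl x≡y x<y) (λ _ _ → proj₁))
        (sym (+-identityʳ _))))
count-remove Q? {y} (suc n) y<1+n qy | no y≢n = cong₂ _+_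
  (count-remove Q? n (≤∧≢⇒< (s≤s⁻¹ y<1+n) y≢n) qy)
  (≤-antisym (indicator-mono (Q? n) ((Q? ∩? ∁? (_≟ y)) n) λ qn → qn , λ n≡y → y≢n (sym n≡y))
             (indicator-mono ((Q? ∩? ∁? (_≟ y)) n) (Q? n) proj₁))

count-injective : {P Q : Pred ℕ 0ℓ} (P? : U.Decidable P) (Q? : U.Decidable Q) (f : ℕ → ℕ) → ∀ M N →
  (∀ x y → x < M → y < M → P x → P y → f x ≡ f y → x ≡ y) →
  (∀ x → x < M → P x → f x < N × Q (f x)) → count P? M ≤ count Q? N
count-injective P? Q? f zero N _ _ = z≤n
count-injective P? Q? f (suc M) N inj maps with P? M
... | no _ = subst (_≤ count Q? N) (sym (+-identityʳ _))
               (count-injective P? Q? f M N (λ x y x<M y<M → inj x y (m<n⇒m<1+n x<M) (m<n⇒m<1+n y<M))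
                                            (λ x x<M → maps x (m<n⇒m<1+n x<M)))
... | yes pM = begin
  count P? M + 1             ≡⟨ +-comm _ 1 ⟩
  suc (count P? M)           ≤⟨ s≤s (count-injective P? (Q? ∩? ∁? (_≟ f M)) f M N inj′ maps′) ⟩
  suc (count (Q? ∩? ∁? (_≟ f M)) N) ≡⟨ sym (count-remove Q? N (proj₁ (maps M ≤-refl pM)) (proj₂ (maps M ≤-refl pM))) ⟩
  count Q? N ∎
  where
  open ≤-Reasoning
  inj′ : ∀ x y → x < M → y < M → _ → _ → f x ≡ f y → x ≡ y
  inj′ x y x<M y<M = inj x y (m<n⇒m<1+n x<M) (m<n⇒m<1+n y<M)
  maps′ : ∀ x → x < M → _ → _
  maps′ x x<M px = proj₁ (maps x (m<n⇒m<1+n x<M) px) , proj₂ (maps x (m<n⇒m<1+n x<M) px) ,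
                   λ fx≡fM → <-irrefl (inj x M (m<n⇒m<1+n x<M) ≤-refl px pM fx≡fM) x<M

count-residue-class : {P : Pred ℕ 0ℓ} (P? : U.Decidable P) → ∀ k d .{{_ : NonZero d}} →
  (∀ x y → P x → P y → x % d ≡ y % d) → count P? (k * d) ≤ k
count-residue-class P? k d same = subst (count P? (k * d) ≤_) (count-all k)
  (count-injective P? (λ _ → yes tt) (_/ d) (k * d) k
    (λ x y _ _ px py x/d≡y/d → begin-equality
       x                   ≡⟨ m≡m%n+[m/n]*n x d ⟩
       x % d + x / d * d   ≡⟨ cong₂ (λ r q → r + q * d) (same x y px py) x/d≡y/d ⟩
       y % d + y / d * d   ≡⟨ m≡m%n+[m/n]*n y d ⟨
       y ∎)
    (λ x x<kd _ → m<n*o⇒m/o<n x<kd , tt))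
  where open ≤-Reasoning

count-+ : {P : Pred ℕ 0ℓ} (P? : U.Decidable P) → ∀ m n → count P? (m + n) ≡ count P? m + count (λ x → P? (m + x)) n
count-+ P? m zero = trans (cong (count P?) (+-identityʳ m)) (sym (+-identityʳ _))
count-+ P? m (suc n) rewrite +-suc m n =
  trans (cong (_+ indicator (P? (m + n))) (count-+ P? m n)) (+-assoc (count P? m) _ _)

[m*n+o]/n≡m×[m*n+o]%n≡o : ∀ m n o .{{_ : NonZero n}} → o < n → (m * n + o) / n ≡ m × (m * n + o) % n ≡ o
[m*n+o]/n≡m×[m*n+o]%n≡o m n o o<n =
  (begin-equality
    (m * n + o) / n     ≡⟨ +-distrib-/-∣ˡ o (n∣m*n m) ⟩
    m * n / n + o / n   ≡⟨ cong₂ _+_ (m*n/n≡m m n) (m<n⇒m/n≡0 o<n) ⟩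
    m + 0               ≡⟨ +-identityʳ m ⟩
    m ∎) ,
  trans (%-remove-+ˡ o (n∣m*n m)) (m<n⇒m%n≡m o<n)
  where open ≤-Reasoning

count-× : {P Q : Pred ℕ 0ℓ} (P? : U.Decidable P) (Q? : U.Decidable Q) → ∀ a b .{{_ : NonZero b}} →
  count (λ z → P? (z / b) ×-dec Q? (z % b)) (a * b) ≡ count P? a * count Q? b
count-× P? Q? zero b = refl
count-× {P} {Q} P? Q? (suc a) b = begin
  count PQ? (b + a * b)                            ≡⟨ cong (count PQ?) (+-comm b (a * b)) ⟩
  count PQ? (a * b + b)                            ≡⟨ count-+ PQ? (a * b) b ⟩
  count PQ? (a * b) + count (λ t → PQ? (a * b + t)) b
    ≡⟨ cong₂ _+_ (count-× P? Q? a b) (count-cong _ (λ t → P? a ×-dec Q? t) b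
                 (λ t t<b → subst id (decoded t t<b)) (λ t t<b → subst id (sym (decoded t t<b)))) ⟩
  count P? a * count Q? b + count (λ t → P? a ×-dec Q? t) b ≡⟨ cong (count P? a * count Q? b +_) (count-const×  b) ⟩
  count P? a * count Q? b + indicator (P? a) * count Q? b ≡⟨ *-distribʳ-+ (count Q? b) (count P? a) _ ⟨
  count P? (suc a) * count Q? b ∎
  where
  open ≡-Reasoning
  PQ? : U.Decidable (λ z → P (z / b) × Q (z % b))
  PQ? z = P? (z / b) ×-dec Q? (z % b)
  decoded : ∀ t → t < b → (P ((a * b + t) / b) × Q ((a * b + t) % b)) ≡ (P a × Q t)
  decoded t t<b = cong₂ (λ u v → P u × Q v) (proj₁ a*b+t) (proj₂ a*b+t)
    where a*b+t : (a * b + t) / b ≡ a × (a * b + t) % b ≡ t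
          a*b+t = [m*n+o]/n≡m×[m*n+o]%n≡o a b t t<b
  count-const× : ∀ n → count (λ t → P? a ×-dec Q? t) n ≡ indicator (P? a) * count Q? n
  count-const× zero = sym (*-zeroʳ (indicator (P? a)))
  count-const× (suc n) = trans (cong₂ _+_ (count-const× n) (indicator-× (P? a) (Q? n)))
                               (sym (*-distribˡ-+ (indicator (P? a)) _ _))

sumTo : (ℕ → ℕ) → ℕ → ℕ
sumTo g zero = 0
sumTo g (suc l) = sumTo g l + g l

sumTo-+ : ∀ g h l → sumTo (λ i → g i + h i) l ≡ sumTo g l + sumTo h l
sumTo-+ g h zero = refl
sumTo-+ g h (suc l) = trans (cong (_+ (g l + h l)) (sumTo-+ g h l)) (interchange (sumTo g l) _ _ _)

≤-sumTo : ∀ g {i l} → i < l → g i ≤ sumTo g l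
≤-sumTo g {i} {suc l} i<1+l with i ≟ l
... | yes refl = m≤n+m (g i) _
... | no i≢l = ≤-trans (≤-sumTo g (≤∧≢⇒< (s≤s⁻¹ i<1+l) i≢l)) (m≤m+n _ (g l))

maxTo : (ℕ → ℕ) → ℕ → ℕ
maxTo g zero = 0
maxTo g (suc l) = maxTo g l ⊔ g l

sumTo≤*maxTo : ∀ g l → sumTo g l ≤ l * maxTo g l
sumTo≤*maxTo g zero = z≤n
sumTo≤*maxTo g (suc l) = begin
  sumTo g l + g l         ≤⟨ +-mono-≤ (sumTo≤*maxTo g l) (m≤n⊔m (maxTo g l) (g l)) ⟩
  l * maxTo g l + M       ≤⟨ +-monoˡ-≤ M (*-monoʳ-≤ l (m≤m⊔n (maxTo g l) (g l))) ⟩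
  l * M + M               ≡⟨ +-comm (l * M) M ⟩
  suc l * M ∎
  where
  open ≤-Reasoning
  M : ℕ
  M = maxTo g (suc l)

maxTo-preserves : (R : Pred ℕ 0ℓ) → R 0 → ∀ g → (∀ i → R (g i)) → ∀ l → R (maxTo g l)
maxTo-preserves R R0 g Rg zero = R0
maxTo-preserves R R0 g Rg (suc l) with ⊔-sel (maxTo g l) (g l)
... | inj₁ M≡maxTo = subst R (sym M≡maxTo) (maxTo-preserves R R0 g Rg l)
... | inj₂ M≡g = subst R (sym M≡g) (Rg l)

count-⋃ : {P : Pred ℕ 0ℓ} {Q : ℕ → Pred ℕ 0ℓ} (P? : U.Decidable P) (Q? : ∀ i → U.Decidable (Q i)) → ∀ l n →
  (∀ x → x < n → P x → ∃ λ i → i < l × Q i x) → count P? n ≤ sumTo (λ i → count (Q? i) n) l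
count-⋃ P? Q? l zero _ = z≤n
count-⋃ {Q = Q} P? Q? l (suc n) P⊆⋃Q = begin
  count P? n + indicator (P? n)
    ≤⟨ +-mono-≤ (count-⋃ P? Q? l n λ x x<n → P⊆⋃Q x (m<n⇒m<1+n x<n)) (indicator-⋃ (P? n)) ⟩
  sumTo (λ i → count (Q? i) n) l + sumTo (λ i → indicator (Q? i n)) l
    ≡⟨ sumTo-+ (λ i → count (Q? i) n) (λ i → indicator (Q? i n)) l ⟨
  sumTo (λ i → count (Q? i) (suc n)) l ∎
  where
  open ≤-Reasoning
  indicator-⋃ : (Pn? : Dec _) → indicator Pn? ≤ sumTo (λ i → indicator (Q? i n)) l
  indicator-⋃ (no _) = z≤n
  indicator-⋃ (yes pn) with P⊆⋃Q n ≤-refl pn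
  ... | i , i<l , qin = ≤-trans (indicator-mono (yes pn) (Q? i n) λ _ → qin)
                                (≤-sumTo (λ i → indicator (Q? i n)) i<l)

-- Roots of monic quadratics modulo m

quadratic : ℕ → ℕ → ℕ → ℕ
quadratic B C x = x * x + B * x + C

rootCount : ℕ → ℕ → ℕ → ℕ
rootCount B C m = count (λ x → m ∣? quadratic B C x) m

rootCount≤m : ∀ B C m → rootCount B C m ≤ m
rootCount≤m B C m = count≤n (λ x → m ∣? quadratic B C x) m

quadratic-+ : ∀ B C y s → quadratic B C (y + s) ≡ quadratic B C y + s * (y + s + (y + B))
quadratic-+ B C y s = expand y s B C
  where expand : ∀ y s B C → (y + s) * (y + s) + B * (y + s) + C ≡ y * y + B * y + C + s * (y + s + (y + B))
        expand = solve-∀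

quadratic-+-∣ : ∀ B C y {s d} → d ∣ s → d ∣ quadratic B C (y + s) → d ∣ quadratic B C y
quadratic-+-∣ B C y {s} {d} d∣s d∣q =
  ∣m+n∣m⇒∣n (subst (d ∣_) (trans (quadratic-+ B C y s) (+-comm (quadratic B C y) _)) d∣q) (∣m⇒∣m*n _ d∣s)

quadratic-%-∣ : ∀ B C x d .{{_ : NonZero d}} → d ∣ quadratic B C x → d ∣ quadratic B C (x % d)
quadratic-%-∣ B C x d d∣qx =
  quadratic-+-∣ B C (x % d) (n∣m*n (x / d)) (subst (λ z → d ∣ quadratic B C z) (m≡m%n+[m/n]*n x d) d∣qx)

data Gap : ℕ → ℕ → ℕ → Set where
  above : ∀ y s → Gap y (y + s) s
  below : ∀ x s → Gap (x + s) x s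

gap : ∀ y x → ∃ (Gap y x)
gap y x with ≤-total y x
... | inj₁ y≤x = x ∸ y , subst (λ z → Gap y z (x ∸ y)) (m+[n∸m]≡n y≤x) (above y (x ∸ y))
... | inj₂ x≤y = y ∸ x , subst (λ z → Gap z x (y ∸ x)) (m+[n∸m]≡n x≤y) (below x (y ∸ x))

gap-0⇒≡ : ∀ {y x s} → Gap y x s → s ≡ 0 → x ≡ y
gap-0⇒≡ (above y _) refl = +-identityʳ y
gap-0⇒≡ (below x _) refl = sym (+-identityʳ x)

gap-< : ∀ {y x s n} → Gap y x s → x < n → y < n → s < n
gap-< (above y s) y+s<n _ = ≤-<-trans (m≤n+m s y) y+s<n
gap-< (below x s) _ x+s<n = ≤-<-trans (m≤n+m s x) x+s<n

[m+n]%d≡m%d⇒d∣n : ∀ m n d .{{_ : NonZero d}} → (m + n) % d ≡ m % d → d ∣ n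
[m+n]%d≡m%d⇒d∣n m n d eq = divides ((m + n) / d ∸ m / d) (begin
  n                                        ≡⟨ m+n∸m≡n m n ⟨
  (m + n) ∸ m                              ≡⟨ cong₂ _∸_ (m≡m%n+[m/n]*n (m + n) d) (m≡m%n+[m/n]*n m d) ⟩
  ((m + n) % d + (m + n) / d * d) ∸ (m % d + m / d * d)
                                           ≡⟨ cong (λ r → (r + (m + n) / d * d) ∸ (m % d + m / d * d)) eq ⟩
  (m % d + (m + n) / d * d) ∸ (m % d + m / d * d) ≡⟨ [m+n]∸[m+o]≡n∸o (m % d) _ _ ⟩
  (m + n) / d * d ∸ m / d * d              ≡⟨ *-distribʳ-∸ d ((m + n) / d) (m / d) ⟨
  ((m + n) / d ∸ m / d) * d ∎)
  where open ≡-Reasoning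

gap-%-≡ : ∀ {y x s} d .{{_ : NonZero d}} → Gap y x s → d ∣ s → x % d ≡ y % d
gap-%-≡ d (above y s) d∣s = %-remove-+ʳ y d∣s
gap-%-≡ d (below x s) d∣s = sym (%-remove-+ʳ x d∣s)

%-≡-gap : ∀ {y x s} d .{{_ : NonZero d}} → Gap y x s → x % d ≡ y % d → d ∣ s
%-≡-gap d (above y s) eq = [m+n]%d≡m%d⇒d∣n y s d eq
%-≡-gap d (below x s) eq = [m+n]%d≡m%d⇒d∣n x s d (sym eq)

∣-+-%-≡ : ∀ d .{{_ : NonZero d}} c x y → d ∣ x + c → d ∣ y + c → x % d ≡ y % d
∣-+-%-≡ d c x y d∣x+c d∣y+c with gap y x
... | s , above y s = gap-%-≡ d (above y s) (∣m+n∣m⇒∣n (subst (d ∣_) (xy∙z≈xz∙y y s c) d∣x+c) d∣y+c)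
... | s , below x s = gap-%-≡ d (below x s) (∣m+n∣m⇒∣n (subst (d ∣_) (xy∙z≈xz∙y x s c) d∣y+c) d∣x+c)

∣∧<⇒≡0 : ∀ {d s} .{{_ : NonZero d}} → d ∣ s → s < d → s ≡ 0
∣∧<⇒≡0 {d} {s} d∣s s<d = trans (sym (m<n⇒m%n≡m s<d)) (n∣m⇒m%n≡0 s d d∣s)

module _ (a b : ℕ) .{{_ : NonZero a}} .{{_ : NonZero b}} (a⊥b : ∀ k → a ∣ k * b → a ∣ k) where

  instance
    ab≢0 : NonZero (a * b)
    ab≢0 = m*n≢0 a b

  ∣∧∣⇒*∣ : ∀ {s} → a ∣ s → b ∣ s → a * b ∣ s
  ∣∧∣⇒*∣ a∣s (divides k refl) = *-monoˡ-∣ b (a⊥b k a∣s)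

  %-injective : ∀ x y → x < a * b → y < a * b → x % a ≡ y % a → x % b ≡ y % b → x ≡ y
  %-injective x y x<ab y<ab ≡a ≡b with gap y x
  ... | s , y~x = gap-0⇒≡ y~x (∣∧<⇒≡0 (∣∧∣⇒*∣ (%-≡-gap a y~x ≡a) (%-≡-gap b y~x ≡b)) (gap-< y~x x<ab y<ab))

  rootCount-* : ∀ B C → rootCount B C (a * b) ≤ rootCount B C a * rootCount B C b
  rootCount-* B C = subst (rootCount B C (a * b) ≤_) (count-× (λ x → a ∣? quadratic B C x) (λ x → b ∣? quadratic B C x) a b)
    (count-injective (λ x → a * b ∣? quadratic B C x) _ encode (a * b) (a * b) encode-injective encode-roots)
    where
    encode : ℕ → ℕ
    encode x = x % a * b + x % b
    decode : ∀ x → encode x / b ≡ x % a × encode x % b ≡ x % b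
    decode x = [m*n+o]/n≡m×[m*n+o]%n≡o (x % a) b (x % b) (m%n<n x b)
    encode< : ∀ x → encode x < a * b
    encode< x = begin-strict
      x % a * b + x % b  <⟨ +-monoʳ-< (x % a * b) (m%n<n x b) ⟩
      x % a * b + b      ≡⟨ +-comm (x % a * b) b ⟩
      suc (x % a) * b    ≤⟨ *-monoˡ-≤ b (m%n<n x a) ⟩
      a * b ∎
      where open ≤-Reasoning
    encode-injective : ∀ x y → x < a * b → y < a * b → _ → _ → encode x ≡ encode y → x ≡ y
    encode-injective x y x<ab y<ab _ _ eq = %-injective x y x<ab y<ab
      (trans (sym (proj₁ (decode x))) (trans (cong (_/ b) eq) (proj₁ (decode y))))
      (trans (sym (proj₂ (decode x))) (trans (cong (_% b) eq) (proj₂ (decode y))))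
    encode-roots : ∀ x → x < a * b → a * b ∣ quadratic B C x →
                   encode x < a * b × (a ∣ quadratic B C (encode x / b) × b ∣ quadratic B C (encode x % b))
    encode-roots x _ ab∣q = encode< x ,
      subst (λ z → a ∣ quadratic B C z) (sym (proj₁ (decode x))) (quadratic-%-∣ B C x a (m*n∣⇒m∣ a b ab∣q)) ,
      subst (λ z → b ∣ quadratic B C z) (sym (proj₂ (decode x))) (quadratic-%-∣ B C x b (m*n∣⇒n∣ a b ab∣q))

  rootCount²-* : ∀ B C → rootCount B C (a * b) * rootCount B C (a * b) ≤
                        (rootCount B C a * rootCount B C a) * (rootCount B C b * rootCount B C b)
  rootCount²-* B C = ≤-trans (*-mono-≤ (rootCount-* B C) (rootCount-* B C))
                             (≤-reflexive (square-* (rootCount B C a) (rootCount B C b)))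
    where square-* : ∀ x y → (x * y) * (x * y) ≡ (x * x) * (y * y)
          square-* = solve-∀

-- with t = x + (x0 + B) and w = x0 + (x0 + B): q x − q x0 = ± s t and t − w = ± s
gap-sides : ∀ B {x0 x s} → Gap x0 x s → x + (x0 + B) ≡ x0 + (x0 + B) + s ⊎ x0 + (x0 + B) ≡ x + (x0 + B) + s
gap-sides B (above x0 s) = inj₁ (sides x0 s B)
  where sides : ∀ a b c → a + b + (a + c) ≡ a + (a + c) + b
        sides = solve-∀
gap-sides B (below x s) = inj₂ (sides x s B)
  where sides : ∀ a b c → a + b + (a + b + c) ≡ a + (a + b + c) + b
        sides = solve-∀

module _ (B : ℕ) {x0 x s : ℕ} (x0~x : Gap x0 x s) where

  gap-∣∧∣⇒∣w : ∀ {d} → d ∣ s → d ∣ x + (x0 + B) → d ∣ x0 + (x0 + B)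
  gap-∣∧∣⇒∣w {d} d∣s d∣t with gap-sides B x0~x
  ... | inj₁ t≡w+s = ∣m+n∣m⇒∣n (subst (d ∣_) (trans t≡w+s (+-comm _ s)) d∣t) d∣s
  ... | inj₂ w≡t+s = subst (d ∣_) (sym w≡t+s) (∣m∣n⇒∣m+n d∣t d∣s)

  gap-∣∧∣⇒∣s : ∀ {d} → d ∣ x + (x0 + B) → d ∣ x0 + (x0 + B) → d ∣ s
  gap-∣∧∣⇒∣s {d} d∣t d∣w with gap-sides B x0~x
  ... | inj₁ t≡w+s = ∣m+n∣m⇒∣n (subst (d ∣_) t≡w+s d∣t) d∣w
  ... | inj₂ w≡t+s = ∣m+n∣m⇒∣n (subst (d ∣_) w≡t+s d∣w) d∣t

module _ {B C M x0 : ℕ} (x0-root : M ∣ quadratic B C x0) where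

  gap-∣-* : ∀ {x s} → Gap x0 x s → M ∣ quadratic B C x → M ∣ s * (x + (x0 + B))
  gap-∣-* (above _ s) x-root = ∣m+n∣m⇒∣n (subst (M ∣_) (quadratic-+ B C x0 s) x-root) x0-root
  gap-∣-* (below x s) x-root = ∣m+n∣m⇒∣n (subst (M ∣_) q[x+s]≡q[x]+s*t x0-root) x-root
    where
    rearrange : ∀ a b c → a + b + (a + c) ≡ a + (a + b + c)
    rearrange = solve-∀
    q[x+s]≡q[x]+s*t : quadratic B C (x + s) ≡ quadratic B C x + s * (x + (x + s + B))
    q[x+s]≡q[x]+s*t = trans (quadratic-+ B C x s) (cong (λ t → quadratic B C x + s * t) (rearrange x s B))

-- Prime power moduli

prime-power-∣-* : ∀ {p} → Prime p → ∀ e s t → p ^ e ∣ s * t →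
                  ∃ λ i → ∃ λ j → i + j ≡ e × p ^ i ∣ s × p ^ j ∣ t
prime-power-∣-* p-prime zero s t _ = 0 , 0 , refl , 1∣ s , 1∣ t
prime-power-∣-* {p} p-prime (suc e) s t pᵉ⁺¹∣st =
  [ (λ p∣s → peel p∣s pᵉ⁺¹∣st)
  , (λ p∣t → swap (peel p∣t (subst (p ^ suc e ∣_) (*-comm s t) pᵉ⁺¹∣st)))
  ]′ (euclidsLemma s t p-prime (∣-trans (m∣m*n (p ^ e)) pᵉ⁺¹∣st))
  where
  instance
    p≢0 : NonZero p
    p≢0 = prime⇒nonZero p-prime
  Split : ℕ → ℕ → Set
  Split a b = ∃ λ i → ∃ λ j → i + j ≡ suc e × p ^ i ∣ a × p ^ j ∣ b
  peel : ∀ {a b} → p ∣ a → p ^ suc e ∣ a * b → Split a b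
  peel {b = b} (divides a′ refl) pᵉ⁺¹∣ab =
    let i , j , i+j≡e , pⁱ∣a′ , pʲ∣b = prime-power-∣-* p-prime e a′ b pᵉ∣a′b
    in suc i , j , cong suc i+j≡e , subst (p * p ^ i ∣_) (*-comm p a′) (*-monoʳ-∣ p pⁱ∣a′) , pʲ∣b
    where
    rearrange : ∀ x y z → x * y * z ≡ y * (x * z)
    rearrange = solve-∀
    pᵉ∣a′b : p ^ e ∣ a′ * b
    pᵉ∣a′b = *-cancelˡ-∣ p (subst (p * p ^ e ∣_) (rearrange a′ p b) pᵉ⁺¹∣ab)
  swap : ∀ {a b} → Split a b → Split b a
  swap (i , j , i+j≡e , pⁱ∣a , pʲ∣b) = j , i , trans (+-comm j i) i+j≡e , pʲ∣b , pⁱ∣a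

prime-power-∣-coprime : ∀ {p b} → Prime p → ¬ p ∣ b → ∀ e k → p ^ e ∣ k * b → p ^ e ∣ k
prime-power-∣-coprime {p} p-prime p∤b e k pᵉ∣kb with prime-power-∣-* p-prime e k _ pᵉ∣kb
... | i , zero , i+0≡e , pⁱ∣k , _ = subst (λ i → p ^ i ∣ k) (trans (sym (+-identityʳ i)) i+0≡e) pⁱ∣k
... | _ , suc _ , _ , _ , pʲ∣b = contradiction (∣-trans (m∣m*n _) pʲ∣b) p∤b

∃-boundary : {P : Pred ℕ 0ℓ} → U.Decidable P → ∀ N → P 0 → ¬ P N → ∃ λ u → P u × ¬ P (suc u)
∃-boundary P? zero p0 ¬pN = contradiction p0 ¬pN
∃-boundary P? (suc N) p0 ¬pN with P? N
... | yes pN = N , pN , ¬pN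
... | no ¬pN′ = ∃-boundary P? N p0 ¬pN′

^-monoʳ-∣ : ∀ p {a b} → a ≤ b → p ^ a ∣ p ^ b
^-monoʳ-∣ p {a} {b} a≤b = divides (p ^ (b ∸ a)) (trans (cong (p ^_) (sym (m∸n+n≡m a≤b))) (^-distribˡ-+-* p (b ∸ a) a))

module PrimePowerRoots {p} (p-prime : Prime p) (e B C x0 : ℕ) (x0-root : p ^ e ∣ quadratic B C x0) where

  instance
    p≢0 : NonZero p
    p≢0 = prime⇒nonZero p-prime

  Admissible : Pred ℕ 0ℓ
  Admissible u = u + u ≤ e × p ^ u ∣ x0 + (x0 + B)

  boundary : ∃ λ u → Admissible u × ¬ Admissible (suc u)
  boundary = ∃-boundary (λ u → u + u ≤? e ×-dec p ^ u ∣? x0 + (x0 + B)) (suc e) (z≤n , 1∣ _)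
                        λ (2[e+1]≤e , _) → <⇒≱ (≤-trans (n<1+n e) (m≤m+n (suc e) (suc e))) 2[e+1]≤e

  u : ℕ
  u = proj₁ boundary

  u+u≤e : u + u ≤ e
  u+u≤e = proj₁ (proj₁ (proj₂ boundary))

  E : ℕ
  E = e ∸ u

  u+E≡e : u + E ≡ e
  u+E≡e = m+[n∸m]≡n (≤-trans (m≤m+n u u) u+u≤e)

  instance
    pᴱ≢0 : NonZero (p ^ E)
    pᴱ≢0 = m^n≢0 p E

  pᵉ≡pᵘ*pᴱ : p ^ e ≡ p ^ u * p ^ E
  pᵉ≡pᵘ*pᴱ = trans (cong (p ^_) (sym u+E≡e)) (^-distribˡ-+-* p u E)

  -- unless pᴱ divides s or t, both are divisible by p^(u + 1), hence so is w: u was not maximal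
  dichotomy : ∀ x → p ^ e ∣ quadratic B C x → x % p ^ E ≡ x0 % p ^ E ⊎ p ^ E ∣ x + (x0 + B)
  dichotomy x x-root with gap x0 x
  ... | s , x0~x with prime-power-∣-* p-prime e s _ (gap-∣-* x0-root x0~x x-root)
  ... | i , j , i+j≡e , pⁱ∣s , pʲ∣t with E ≤? i | E ≤? j
  ...   | yes E≤i | _ = inj₁ (gap-%-≡ (p ^ E) x0~x (∣-trans (^-monoʳ-∣ p E≤i) pⁱ∣s))
  ...   | no _ | yes E≤j = inj₂ (∣-trans (^-monoʳ-∣ p E≤j) pʲ∣t)
  ...   | no E≰i | no E≰j = contradiction (2[u+1]≤e , pᵘ⁺¹∣w) (proj₂ (proj₂ boundary))
    where
    u<i : u < i
    u<i = ≰⇒> λ i≤u → <-irrefl (trans i+j≡e (sym u+E≡e)) (+-mono-≤-< i≤u (≰⇒> E≰j))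
    u<j : u < j
    u<j = ≰⇒> λ j≤u → <-irrefl (trans i+j≡e (trans (sym u+E≡e) (+-comm u E))) (+-mono-<-≤ (≰⇒> E≰i) j≤u)
    2[u+1]≤e : suc u + suc u ≤ e
    2[u+1]≤e = subst (suc u + suc u ≤_) i+j≡e (+-mono-≤ u<i u<j)
    pᵘ⁺¹∣w : p ^ suc u ∣ x0 + (x0 + B)
    pᵘ⁺¹∣w = gap-∣∧∣⇒∣w B x0~x (∣-trans (^-monoʳ-∣ p u<i) pⁱ∣s) (∣-trans (^-monoʳ-∣ p u<j) pʲ∣t)

  residue-class? : U.Decidable (λ x → x % p ^ E ≡ x0 % p ^ E)
  residue-class? x = x % p ^ E ≟ x0 % p ^ E

  residue-class≤ : count residue-class? (p ^ e) ≤ p ^ u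
  residue-class≤ = subst (λ n → count residue-class? n ≤ p ^ u) (sym pᵉ≡pᵘ*pᴱ)
    (count-residue-class residue-class? (p ^ u) (p ^ E) λ x y x≡x0 y≡x0 → trans x≡x0 (sym y≡x0))

  shifted-class? : U.Decidable (λ x → p ^ E ∣ x + (x0 + B))
  shifted-class? x = p ^ E ∣? x + (x0 + B)

  shifted-class≤ : count shifted-class? (p ^ e) ≤ p ^ u
  shifted-class≤ = subst (λ n → count shifted-class? n ≤ p ^ u) (sym pᵉ≡pᵘ*pᴱ)
    (count-residue-class shifted-class? (p ^ u) (p ^ E) (∣-+-%-≡ (p ^ E) (x0 + B)))

  rootCount≤2pᵘ : rootCount B C (p ^ e) ≤ 2 * p ^ u
  rootCount≤2pᵘ = begin
    rootCount B C (p ^ e)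
      ≤⟨ count-∪ _ residue-class? shifted-class? (p ^ e) (λ x _ → dichotomy x) ⟩
    count residue-class? (p ^ e) + count shifted-class? (p ^ e)
      ≤⟨ +-mono-≤ residue-class≤ shifted-class≤ ⟩
    p ^ u + p ^ u
      ≡⟨ cong (p ^ u +_) (+-identityʳ (p ^ u)) ⟨
    2 * p ^ u ∎
    where open ≤-Reasoning

  -- when u + u ≡ e the two classes coincide, since then pᴱ = pᵘ divides x0 + (x0 + B)
  rootCount≤pᵘ : u + u ≡ e → rootCount B C (p ^ e) ≤ p ^ u
  rootCount≤pᵘ u+u≡e = ≤-trans (count-mono _ residue-class? (p ^ e) λ x _ → in-residue-class x) residue-class≤
    where
    pᴱ∣w : p ^ E ∣ x0 + (x0 + B)
    pᴱ∣w = subst (λ k → p ^ k ∣ x0 + (x0 + B)) (sym (trans (cong (_∸ u) (sym u+u≡e)) (m+n∸m≡n u u)))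
                 (proj₂ (proj₁ (proj₂ boundary)))
    in-residue-class : ∀ x → p ^ e ∣ quadratic B C x → x % p ^ E ≡ x0 % p ^ E
    in-residue-class x x-root with dichotomy x x-root | gap x0 x
    ... | inj₁ same-residue | _ = same-residue
    ... | inj₂ pᴱ∣t | s , x0~x = gap-%-≡ (p ^ E) x0~x (gap-∣∧∣⇒∣s B x0~x pᴱ∣t pᴱ∣w)

rootCount-prime-power : ∀ {p} → Prime p → ∀ e B C → ∃ λ u →
  u + u ≤ e × rootCount B C (p ^ e) ≤ 2 * p ^ u × (u + u ≡ e → rootCount B C (p ^ e) ≤ p ^ u)
rootCount-prime-power {p} p-prime e B C with 0 <? rootCount B C (p ^ e)
... | no no-root = 0 , z≤n , ≤-trans (≮⇒≥ no-root) z≤n , λ _ → ≤-trans (≮⇒≥ no-root) z≤n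
... | yes some-root with count-witness _ (p ^ e) some-root
... | x0 , _ , x0-root = u , u+u≤e , rootCount≤2pᵘ , rootCount≤pᵘ
  where open PrimePowerRoots p-prime e B C x0 x0-root

[2*pᵘ]²≡4*pᵘ⁺ᵘ : ∀ p u → (2 * p ^ u) * (2 * p ^ u) ≡ 4 * p ^ (u + u)
[2*pᵘ]²≡4*pᵘ⁺ᵘ p u = trans (square-2* (p ^ u)) (cong (4 *_) (sym (^-distribˡ-+-* p u u)))
  where square-2* : ∀ a → (2 * a) * (2 * a) ≡ 4 * (a * a)
        square-2* = solve-∀

rootCount²-prime-power : ∀ {p} → Prime p → ∀ e B C → rootCount B C (p ^ e) * rootCount B C (p ^ e) ≤ 4 * p ^ e
rootCount²-prime-power {p} p-prime e B C with rootCount-prime-power p-prime e B C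
... | u , u+u≤e , R≤2pᵘ , _ = begin
  rootCount B C (p ^ e) * rootCount B C (p ^ e) ≤⟨ *-mono-≤ R≤2pᵘ R≤2pᵘ ⟩
  (2 * p ^ u) * (2 * p ^ u)                     ≡⟨ [2*pᵘ]²≡4*pᵘ⁺ᵘ p u ⟩
  4 * p ^ (u + u)                               ≤⟨ *-monoʳ-≤ 4 (^-monoʳ-≤ p {{prime⇒nonZero p-prime}} u+u≤e) ⟩
  4 * p ^ e ∎
  where open ≤-Reasoning

rootCount²-prime-power-≥5 : ∀ {p} → Prime p → 5 ≤ p → ∀ e B C → rootCount B C (p ^ e) * rootCount B C (p ^ e) ≤ p ^ e
rootCount²-prime-power-≥5 {p} p-prime 5≤p e B C with rootCount-prime-power p-prime e B C
... | u , u+u≤e , R≤2pᵘ , u+u≡e⇒R≤pᵘ with u + u ≟ e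
...   | yes u+u≡e = ≤-trans (*-mono-≤ (u+u≡e⇒R≤pᵘ u+u≡e) (u+u≡e⇒R≤pᵘ u+u≡e))
                            (≤-reflexive (trans (sym (^-distribˡ-+-* p u u)) (cong (p ^_) u+u≡e)))
...   | no u+u≢e = begin
  rootCount B C (p ^ e) * rootCount B C (p ^ e) ≤⟨ *-mono-≤ R≤2pᵘ R≤2pᵘ ⟩
  (2 * p ^ u) * (2 * p ^ u)                     ≡⟨ [2*pᵘ]²≡4*pᵘ⁺ᵘ p u ⟩
  4 * p ^ (u + u)                               ≤⟨ *-monoˡ-≤ (p ^ (u + u)) (≤-trans (n≤1+n 4) 5≤p) ⟩
  p ^ suc (u + u)                               ≤⟨ ^-monoʳ-≤ p {{prime⇒nonZero p-prime}} (≤∧≢⇒< u+u≤e u+u≢e) ⟩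
  p ^ e ∎
  where open ≤-Reasoning

rootCount-prime : ∀ {p} → Prime p → ∀ B C → rootCount B C p ≤ 2
rootCount-prime {p} p-prime B C with rootCount-prime-power p-prime 1 B C
... | zero , _ , R≤2 , _ = subst (λ n → rootCount B C n ≤ 2) (*-identityʳ p) R≤2
... | suc u , s≤s u+[1+u]≤0 , _ , _ = contradiction u+[1+u]≤0 (<⇒≱ (≤-trans (s≤s z≤n) (m≤n+m (suc u) u)))

-- Arbitrary moduli

prime>1 : ∀ {p} → Prime p → 1 < p
prime>1 {p} p-prime = nonTrivial⇒n>1 p {{prime⇒nonTrivial p-prime}}

prime-factor : ∀ m .{{_ : NonZero m}} → m ≢ 1 → ∃ λ p → Prime p × p ∣ m
prime-factor m m≢1 with factorise m
... | record { factors = [] ; isFactorisation = m≡1 } = contradiction m≡1 m≢1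
... | record { factors = p ∷ ps ; isFactorisation = m≡p*Πps ; factorsPrime = p-prime ∷ _ } =
  p , p-prime , divides (product ps) (trans m≡p*Πps (*-comm p (product ps)))

prime-power-part : ∀ {p} → Prime p → ∀ m .{{_ : NonZero m}} → ∃ λ e → ∃ λ m′ → m ≡ p ^ e * m′ × ¬ p ∣ m′
prime-power-part {p} p-prime m = go m (<-wellFounded m)
  where
  go : ∀ m .{{_ : NonZero m}} → Acc _<_ m → ∃ λ e → ∃ λ m′ → m ≡ p ^ e * m′ × ¬ p ∣ m′
  go m (acc rec) with p ∣? m
  ... | no p∤m = 0 , m , sym (+-identityʳ m) , p∤m
  ... | yes (divides k m≡k*p) =
    let e , m′ , k≡pᵉ*m′ , p∤m′ = go k (rec k<m)
    in suc e , m′ , trans m≡k*p (trans (cong (_* p) k≡pᵉ*m′) (rearrange (p ^ e) m′ p)) , p∤m′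
    where
    instance
      k≢0 : NonZero k
      k≢0 = m*n≢0⇒m≢0 k {{subst NonZero m≡k*p it}}
    k<m : k < m
    k<m = subst (k <_) (sym m≡k*p) (m<m*n k p (prime>1 p-prime))
    rearrange : ∀ a b c → a * b * c ≡ c * a * b
    rearrange = solve-∀

module _ (F : ℕ → ℕ) (Good : Pred ℕ 0ℓ) (F[1]≤1 : F 1 ≤ 1)
         (F-* : ∀ a b .{{_ : NonZero a}} .{{_ : NonZero b}} → (∀ k → a ∣ k * b → a ∣ k) → F (a * b) ≤ F a * F b)
         (F-prime-power : ∀ {p} → Prime p → Good p → ∀ e → F (p ^ e) ≤ p ^ e) where

  ≤-of-good-prime-factors : ∀ m .{{_ : NonZero m}} → (∀ {p} → Prime p → p ∣ m → Good p) → F m ≤ m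
  ≤-of-good-prime-factors m = go m (<-wellFounded m)
    where
    go : ∀ m .{{_ : NonZero m}} → Acc _<_ m → (∀ {p} → Prime p → p ∣ m → Good p) → F m ≤ m
    go m (acc rec) good with m ≟ 1
    ... | yes refl = F[1]≤1
    ... | no m≢1 with prime-factor m m≢1
    ... | p , p-prime , p∣m with prime-power-part p-prime m
    ... | zero , m′ , m≡m′ , p∤m′ = contradiction (subst (p ∣_) (trans m≡m′ (*-identityˡ m′)) p∣m) p∤m′
    ... | suc e , m′ , m≡pᵉ⁺¹*m′ , p∤m′ = begin
      F m                          ≡⟨ cong F m≡pᵉ⁺¹*m′ ⟩
      F (p ^ suc e * m′)           ≤⟨ F-* (p ^ suc e) m′ (prime-power-∣-coprime p-prime p∤m′ (suc e)) ⟩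
      F (p ^ suc e) * F m′         ≤⟨ *-mono-≤ (F-prime-power p-prime (good p-prime p∣m) (suc e))
                                               (go m′ (rec m′<m) λ q-prime q∣m′ → good q-prime (∣-trans q∣m′ m′∣m)) ⟩
      p ^ suc e * m′               ≡⟨ m≡pᵉ⁺¹*m′ ⟨
      m ∎
      where
      open ≤-Reasoning
      instance
        p≢0 : NonZero p
        p≢0 = prime⇒nonZero p-prime
        pᵉ⁺¹≢0 : NonZero (p ^ suc e)
        pᵉ⁺¹≢0 = m^n≢0 p (suc e)
        m′≢0 : NonZero m′
        m′≢0 = m*n≢0⇒n≢0 (p ^ suc e) {{subst NonZero m≡pᵉ⁺¹*m′ it}}
      m′∣m : m′ ∣ m
      m′∣m = divides (p ^ suc e) m≡pᵉ⁺¹*m′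
      m′<m : m′ < m
      m′<m = subst (m′ <_) (trans (*-comm m′ _) (sym m≡pᵉ⁺¹*m′))
                   (m<m*n m′ (p ^ suc e) (≤-trans (prime>1 p-prime) (m≤m*n p (p ^ e) {{m^n≢0 p e}})))

prime-≥5 : ∀ {p} → Prime p → ¬ 2 ∣ p → ¬ 3 ∣ p → 5 ≤ p
prime-≥5 {0} p-prime _ _ = contradiction p-prime ¬prime[0]
prime-≥5 {1} p-prime _ _ = contradiction p-prime ¬prime[1]
prime-≥5 {2} _ 2∤2 _ = contradiction ∣-refl 2∤2
prime-≥5 {3} _ _ 3∤3 = contradiction ∣-refl 3∤3
prime-≥5 {4} _ 2∤4 _ = contradiction (divides 2 refl) 2∤4
prime-≥5 {suc (suc (suc (suc (suc _))))} _ _ _ = s≤s (s≤s (s≤s (s≤s (s≤s z≤n))))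

prime[3] : Prime 3
prime[3] = from-yes (prime? 3)

rootCount²≤m : ∀ B C m .{{_ : NonZero m}} → (∀ {p} → Prime p → p ∣ m → 5 ≤ p) →
               rootCount B C m * rootCount B C m ≤ m
rootCount²≤m B C = ≤-of-good-prime-factors R² (5 ≤_) R²[1]≤1 R²-* R²-prime-power
  where
  R² : ℕ → ℕ
  R² n = rootCount B C n * rootCount B C n
  R²[1]≤1 : R² 1 ≤ 1
  R²[1]≤1 = *-mono-≤ (rootCount≤m B C 1) (rootCount≤m B C 1)
  R²-* : ∀ a b .{{_ : NonZero a}} .{{_ : NonZero b}} → (∀ k → a ∣ k * b → a ∣ k) → R² (a * b) ≤ R² a * R² b
  R²-* a b a⊥b = rootCount²-* a b a⊥b B C
  R²-prime-power : ∀ {p} → Prime p → 5 ≤ p → ∀ e → R² (p ^ e) ≤ p ^ e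
  R²-prime-power p-prime 5≤p e = rootCount²-prime-power-≥5 p-prime 5≤p e B C

2-3-decomposition : ∀ m .{{_ : NonZero m}} →
  ∃ λ a → ∃ λ b → ∃ λ m′ → m ≡ 2 ^ a * (3 ^ b * m′) × ¬ 2 ∣ 3 ^ b * m′ × ¬ 3 ∣ m′
2-3-decomposition m with prime-power-part prime[2] m
... | a , m₁ , m≡2ᵃ*m₁ , 2∤m₁ with prime-power-part prime[3] m₁ {{m*n≢0⇒n≢0 (2 ^ a) {{subst NonZero m≡2ᵃ*m₁ it}}}}
... | b , m′ , m₁≡3ᵇ*m′ , 3∤m′ =
  a , b , m′ , trans m≡2ᵃ*m₁ (cong (2 ^ a *_) m₁≡3ᵇ*m′) , subst (λ k → ¬ 2 ∣ k) m₁≡3ᵇ*m′ 2∤m₁ , 3∤m′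

rootCount²≤16* : ∀ B C m .{{_ : NonZero m}} → rootCount B C m * rootCount B C m ≤ 16 * m
rootCount²≤16* B C m with 2-3-decomposition m
... | a , b , m′ , m≡2ᵃ*3ᵇ*m′ , 2∤3ᵇm′ , 3∤m′ = begin
  R² m
    ≡⟨ cong R² m≡2ᵃ*3ᵇ*m′ ⟩
  R² (2 ^ a * (3 ^ b * m′))
    ≤⟨ rootCount²-* (2 ^ a) (3 ^ b * m′) (prime-power-∣-coprime prime[2] 2∤3ᵇm′ a) B C ⟩
  R² (2 ^ a) * R² (3 ^ b * m′)
    ≤⟨ *-monoʳ-≤ (R² (2 ^ a)) (rootCount²-* (3 ^ b) m′ (prime-power-∣-coprime prime[3] 3∤m′ b) B C) ⟩
  R² (2 ^ a) * (R² (3 ^ b) * R² m′)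
    ≤⟨ *-mono-≤ (rootCount²-prime-power prime[2] a B C)
                (*-mono-≤ (rootCount²-prime-power prime[3] b B C) (rootCount²≤m B C m′ m′-good)) ⟩
  (4 * 2 ^ a) * ((4 * 3 ^ b) * m′)
    ≡⟨ rearrange (2 ^ a) (3 ^ b) m′ ⟩
  16 * (2 ^ a * (3 ^ b * m′))
    ≡⟨ cong (16 *_) m≡2ᵃ*3ᵇ*m′ ⟨
  16 * m ∎
  where
  open ≤-Reasoning
  R² : ℕ → ℕ
  R² n = rootCount B C n * rootCount B C n
  instance
    2ᵃ≢0 : NonZero (2 ^ a)
    2ᵃ≢0 = m^n≢0 2 a
    3ᵇ≢0 : NonZero (3 ^ b)
    3ᵇ≢0 = m^n≢0 3 b
    3ᵇm′≢0 : NonZero (3 ^ b * m′)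
    3ᵇm′≢0 = m*n≢0⇒n≢0 (2 ^ a) {{subst NonZero m≡2ᵃ*3ᵇ*m′ it}}
    m′≢0 : NonZero m′
    m′≢0 = m*n≢0⇒n≢0 (3 ^ b)
  m′-good : ∀ {p} → Prime p → p ∣ m′ → 5 ≤ p
  m′-good p-prime p∣m′ = prime-≥5 p-prime (λ 2∣p → 2∤3ᵇm′ (∣-trans 2∣p (∣-trans p∣m′ (n∣m*n (3 ^ b)))))
                                          (λ 3∣p → 3∤m′ (∣-trans 3∣p p∣m′))
  rearrange : ∀ x y z → (4 * x) * ((4 * y) * z) ≡ 16 * (x * (y * z))
  rearrange = solve-∀

-- Cyclic groups and cyclotomic mappings

%≡%⇒∣+[n∸1]* : ∀ X Y n .{{_ : NonZero n}} → X % n ≡ Y % n → n ∣ X + (n ∸ 1) * Y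
%≡%⇒∣+[n∸1]* X Y n@(suc n-1) X≡Y = m%n≡0⇒n∣m _ n (begin
  (X + n-1 * Y) % n                  ≡⟨ %-distribˡ-+ X (n-1 * Y) n ⟩
  (X % n + (n-1 * Y) % n) % n        ≡⟨ cong (λ r → (r + (n-1 * Y) % n) % n) X≡Y ⟩
  (Y % n + (n-1 * Y) % n) % n        ≡⟨ %-distribˡ-+ Y (n-1 * Y) n ⟨
  (n * Y) % n                        ≡⟨ n∣m⇒m%n≡0 _ n (m∣m*n Y) ⟩
  0 ∎)
  where open ≡-Reasoning

module CyclicGroup (G : Group 0ℓ 0ℓ) where
  open Group G using (Carrier; _≈_; _∙_; ε; ∙-cong; ∙-congˡ; ∙-congʳ; identityʳ; monoid; setoid)
    renaming (refl to ≈-refl; sym to ≈-sym; trans to ≈-trans; reflexive to ≈-reflexive)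
  open import Algebra.Properties.Monoid.Mult monoid using (×-congʳ; ×-homo-+; ×-assocˡ) renaming (_×_ to _·_)
  open import Algebra.Properties.Group G using (identityʳ-unique)
  import Relation.Binary.Reasoning.Setoid setoid as ≈-Reasoning

  pow≡× : ∀ x k → pow G x k ≡ k · x
  pow≡× x zero = refl
  pow≡× x (suc k) = cong (x ∙_) (pow≡× x k)

  pow-+ : ∀ x a b → pow G x (a + b) ≈ pow G x a ∙ pow G x b
  pow-+ x a b rewrite pow≡× x (a + b) | pow≡× x a | pow≡× x b = ×-homo-+ x a b

  pow-* : ∀ x a b → pow G (pow G x a) b ≈ pow G x (a * b)
  pow-* x a b rewrite pow≡× (pow G x a) b | pow≡× x a | pow≡× x (a * b) | *-comm a b = ×-assocˡ x b a

  pow-cong : ∀ {x y} k → x ≈ y → pow G x k ≈ pow G y k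
  pow-cong {x} {y} k x≈y rewrite pow≡× x k | pow≡× y k = ×-congʳ k x≈y

  pow-ε : ∀ k → pow G ε k ≈ ε
  pow-ε zero = ≈-refl
  pow-ε (suc k) = ≈-trans (∙-congˡ (pow-ε k)) (identityʳ ε)

  pow∈coset : ∀ γ {n ℓ} .{{_ : NonZero ℓ}} → ℓ ∣ n → ∀ {x} → x < n → InCoset G γ n ℓ (x % ℓ) (pow G γ x)
  pow∈coset γ {n} {ℓ} ℓ∣n {x} x<n =
    x / ℓ , m<n*o⇒m/o<n (subst (x <_) (sym (m/n*n≡m ℓ∣n)) x<n) ,
    ≈-trans (≈-reflexive (cong (pow G γ) (m≡m%n+[m/n]*n x ℓ))) (pow-+ γ (x % ℓ) (x / ℓ * ℓ))

  module Cyclic {γ n} (cyclic : IsCyclicOfOrder G γ n) .{{_ : NonZero n}} where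

    pow-injective : ∀ {a b} → a < n → b < n → pow G γ a ≈ pow G γ b → a ≡ b
    pow-injective {a} {b} a<n b<n γᵃ≈γᵇ = begin
      a                      ≡⟨ toℕ-fromℕ< a<n ⟨
      toℕ (fromℕ< a<n)       ≡⟨ cong toℕ (proj₂ cyclic (fromℕ< a<n) (fromℕ< b<n) γ^a′≈γ^b′) ⟩
      toℕ (fromℕ< b<n)       ≡⟨ toℕ-fromℕ< b<n ⟩
      b ∎
      where
      open ≡-Reasoning
      γ^a′≈γ^b′ : pow G γ (toℕ (fromℕ< a<n)) ≈ pow G γ (toℕ (fromℕ< b<n))
      γ^a′≈γ^b′ = ≈-trans (≈-reflexive (cong (pow G γ) (toℕ-fromℕ< a<n)))
                          (≈-trans γᵃ≈γᵇ (≈-reflexive (cong (pow G γ) (sym (toℕ-fromℕ< b<n)))))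

    log : Carrier → ℕ
    log x = toℕ (proj₁ (proj₁ cyclic x))

    pow-log : ∀ x → x ≈ pow G γ (log x)
    pow-log x = proj₂ (proj₁ cyclic x)

    log<n : ∀ x → log x < n
    log<n x = toℕ<n (proj₁ (proj₁ cyclic x))

    γⁿ≈ε : pow G γ n ≈ ε
    γⁿ≈ε = pow-≈⇒≈ε (log (pow G γ n)) (log<n _) (pow-log _)
      where
      pow-≈⇒≈ε : ∀ a → a < n → pow G γ n ≈ pow G γ a → pow G γ n ≈ ε
      pow-≈⇒≈ε zero _ γⁿ≈γ⁰ = γⁿ≈γ⁰
      pow-≈⇒≈ε a@(suc _) a<n γⁿ≈γᵃ = contradiction (pow-injective n∸a<n (>-nonZero⁻¹ n) γⁿ⁻ᵃ≈ε) n∸a≢0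
        where
        n∸a<n : n ∸ a < n
        n∸a<n = ∸-monoʳ-< z<s (<⇒≤ a<n)
        n∸a≢0 : n ∸ a ≢ 0
        n∸a≢0 n∸a≡0 = <⇒≱ a<n (m∸n≡0⇒m≤n n∸a≡0)
        γⁿ⁻ᵃ≈ε : pow G γ (n ∸ a) ≈ ε
        γⁿ⁻ᵃ≈ε = identityʳ-unique (pow G γ a) _ (≈-trans (≈-sym (pow-+ γ a (n ∸ a)))
                   (≈-trans (≈-reflexive (cong (pow G γ) (m+[n∸m]≡n (<⇒≤ a<n)))) γⁿ≈γᵃ))

    pow-% : ∀ x → pow G γ x ≈ pow G γ (x % n)
    pow-% x = begin
      pow G γ x                                  ≡⟨ cong (pow G γ) x≡x%n+n*[x/n] ⟩
      pow G γ (x % n + n * (x / n))              ≈⟨ pow-+ γ (x % n) (n * (x / n)) ⟩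
      pow G γ (x % n) ∙ pow G γ (n * (x / n))    ≈⟨ ∙-congˡ (pow-* γ n (x / n)) ⟨
      pow G γ (x % n) ∙ pow G (pow G γ n) (x / n) ≈⟨ ∙-congˡ (≈-trans (pow-cong (x / n) γⁿ≈ε) (pow-ε (x / n))) ⟩
      pow G γ (x % n) ∙ ε                        ≈⟨ identityʳ _ ⟩
      pow G γ (x % n) ∎
      where
      open ≈-Reasoning
      x≡x%n+n*[x/n] : x ≡ x % n + n * (x / n)
      x≡x%n+n*[x/n] = trans (m≡m%n+[m/n]*n x n) (cong (x % n +_) (*-comm (x / n) n))

    pow-≈⇒%≡ : ∀ x y → pow G γ x ≈ pow G γ y → x % n ≡ y % n
    pow-≈⇒%≡ x y γˣ≈γʸ = pow-injective (m%n<n x n) (m%n<n y n) (≈-trans (≈-sym (pow-% x)) (≈-trans γˣ≈γʸ (pow-% y)))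


    module Cyclotomic {ℓ} .{{_ : NonZero ℓ}} (ℓ∣n : ℓ ∣ n) {f} (cyclotomic : IsCyclotomic G γ n ℓ f) where

      coset : ℕ → Fin ℓ
      coset i = fromℕ< (m%n<n i ℓ)

      coefficient : Fin ℓ → Carrier
      coefficient = proj₁ (proj₂ (proj₂ cyclotomic))

      -- γ^(x²) = a_i γ^(x r) = γ^(log a_i + x r) means x² + (n − 1)(log a_i + x r) ≡ 0 (mod n)
      B : ℕ
      B = (n ∸ 1) * proj₁ cyclotomic

      C : ℕ → ℕ
      C i = (n ∸ 1) * log (coefficient (coset i))

      fixed-point⇒root : ∀ x → x < n → f (pow G γ x) ≈ pow G γ (x * x) → n ∣ quadratic B (C (x % ℓ)) x
      fixed-point⇒root x x<n fixed =
        subst (n ∣_) (rearrange x (n ∸ 1) r b)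
              (%≡%⇒∣+[n∸1]* (x * x) (b + x * r) n (pow-≈⇒%≡ (x * x) (b + x * r) γˣˣ≈γᵇ⁺ˣʳ))
        where
        r : ℕ
        r = proj₁ cyclotomic
        i : Fin ℓ
        i = coset (x % ℓ)
        b : ℕ
        b = log (coefficient i)
        rearrange : ∀ x m r b → x * x + m * (b + x * r) ≡ x * x + m * r * x + m * b
        rearrange = solve-∀
        γˣ∈Cᵢ : InCoset G γ n ℓ (toℕ i) (pow G γ x)
        γˣ∈Cᵢ = subst (λ j → InCoset G γ n ℓ j (pow G γ x)) (sym (trans (toℕ-fromℕ< _) (m%n%n≡m%n x ℓ)))
                      (pow∈coset γ ℓ∣n x<n)
        γˣˣ≈γᵇ⁺ˣʳ : pow G γ (x * x) ≈ pow G γ (b + x * r)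
        γˣˣ≈γᵇ⁺ˣʳ = begin
          pow G γ (x * x)                 ≈⟨ fixed ⟨
          f (pow G γ x)                   ≈⟨ proj₂ (proj₂ (proj₂ cyclotomic)) i (pow G γ x) γˣ∈Cᵢ ⟩
          coefficient i ∙ pow G (pow G γ x) r ≈⟨ ∙-cong (pow-log (coefficient i)) (pow-* γ x r) ⟩
          pow G γ b ∙ pow G γ (x * r)     ≈⟨ pow-+ γ b (x * r) ⟨
          pow G γ (b + x * r) ∎
          where open ≈-Reasoning

module _ (G : Group 0ℓ 0ℓ) (_≈?_ : Decidable (Group._≈_ G)) (γ : Group.Carrier G)
         (f : Group.Carrier G → Group.Carrier G) where

  DH-fixed? : U.Decidable (λ k → Group._≈_ G (f (pow G γ k)) (pow G γ (k * k)))
  DH-fixed? k = f (pow G γ k) ≈? pow G γ (k * k)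

  -- countDH n f runs its local function go (which takes n as a hidden parameter) on n; go cannot be
  -- named from outside, so `helper` is a metavariable that unification in `_` solves to N ↦ go_N
  private
    mutual
      helper : ℕ → ℕ → ℕ
      helper = _

      _ : ∀ k → countDH G _≈?_ γ (suc k) f ≡ countDH G _≈?_ γ (suc k) f
      _ = unify
        where
        unify : ∀ k → countDH G _≈?_ γ (suc k) f ≡ countDH G _≈?_ γ (suc k) f
        unify k with f (pow G γ k) ≈? pow G γ (k * k) | suc k
        ... | yes _ | N = cong suc (refl {x = helper N k})
        ... | no _ | N = refl {x = helper N k}

    helper≡count : ∀ N k → helper N k ≡ count DH-fixed? k
    helper≡count N zero = refl
    helper≡count N (suc k) with f (pow G γ k) ≈? pow G γ (k * k)
    ... | yes _ = trans (cong suc (helper≡count N k)) (+-comm 1 _)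
    ... | no _ = trans (helper≡count N k) (sym (+-identityʳ _))

  countDH≡count : ∀ n → countDH G _≈?_ γ n f ≡ count DH-fixed? n
  countDH≡count n = helper≡count n n

module _ (G : Group 0ℓ 0ℓ) (_≈?_ : Decidable (Group._≈_ G)) {γ n} (cyclic : IsCyclicOfOrder G γ n) .{{_ : NonZero n}}
         {ℓ} .{{_ : NonZero ℓ}} (ℓ∣n : ℓ ∣ n) {f} (cyclotomic : IsCyclotomic G γ n ℓ f) where

  open CyclicGroup.Cyclic G cyclic
  open Cyclotomic ℓ∣n cyclotomic

  roots : ℕ → ℕ
  roots i = rootCount B (C i) n

  countDH≤ℓ*maxTo : countDH G _≈?_ γ n f ≤ ℓ * maxTo roots ℓ
  countDH≤ℓ*maxTo = begin
    countDH G _≈?_ γ n f     ≡⟨ countDH≡count G _≈?_ γ f n ⟩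
    count (DH-fixed? G _≈?_ γ f) n
      ≤⟨ count-⋃ _ _ ℓ n (λ x x<n fixed → x % ℓ , m%n<n x ℓ , fixed-point⇒root x x<n fixed) ⟩
    sumTo roots ℓ            ≤⟨ sumTo≤*maxTo roots ℓ ⟩
    ℓ * maxTo roots ℓ ∎
    where open ≤-Reasoning

  countDH²≤16ℓ²n : countDH G _≈?_ γ n f * countDH G _≈?_ γ n f ≤ 16 * (ℓ * ℓ) * n
  countDH²≤16ℓ²n = begin
    countDH G _≈?_ γ n f * countDH G _≈?_ γ n f  ≤⟨ *-mono-≤ countDH≤ℓ*maxTo countDH≤ℓ*maxTo ⟩
    (ℓ * M) * (ℓ * M)                            ≡⟨ rearrange ℓ M ⟩
    (ℓ * ℓ) * (M * M)                            ≤⟨ *-monoʳ-≤ (ℓ * ℓ) M²≤16n ⟩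
    (ℓ * ℓ) * (16 * n)                           ≡⟨ rearrange′ (ℓ * ℓ) n ⟩
    16 * (ℓ * ℓ) * n ∎
    where
    open ≤-Reasoning
    M : ℕ
    M = maxTo roots ℓ
    M²≤16n : M * M ≤ 16 * n
    M²≤16n = maxTo-preserves (λ M → M * M ≤ 16 * n) z≤n roots (λ i → rootCount²≤16* B (C i) n) ℓ
    rearrange : ∀ a b → (a * b) * (a * b) ≡ (a * a) * (b * b)
    rearrange = solve-∀
    rearrange′ : ∀ a b → a * (16 * b) ≡ 16 * a * b
    rearrange′ = solve-∀

  countDH≤2ℓ : Prime n → countDH G _≈?_ γ n f ≤ 2 * ℓ
  countDH≤2ℓ n-prime = begin
    countDH G _≈?_ γ n f     ≤⟨ countDH≤ℓ*maxTo ⟩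
    ℓ * maxTo roots ℓ        ≤⟨ *-monoʳ-≤ ℓ (maxTo-preserves (_≤ 2) z≤n roots roots≤2 ℓ) ⟩
    ℓ * 2                    ≡⟨ *-comm ℓ 2 ⟩
    2 * ℓ ∎
    where
    open ≤-Reasoning
    roots≤2 : ∀ i → roots i ≤ 2
    roots≤2 i = rootCount-prime n-prime B (C i)

theorem2 : Σ ℕ λ c → (0 < c) ×
    ((G : Group 0ℓ 0ℓ) (_≈?_ : Decidable (Group._≈_ G)) (γ : Group.Carrier G) (n : ℕ) →
     2 ≤ n → IsCyclicOfOrder G γ n →
     (ℓ : ℕ) .{{_ : NonZero ℓ}} → ℓ ∣ n →
     (f : Group.Carrier G → Group.Carrier G) → IsCyclotomic G γ n ℓ f →
     (countDH G _≈?_ γ n f * countDH G _≈?_ γ n f ≤ (c * c) * (ℓ * ℓ) * n)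
     × (Prime n → countDH G _≈?_ γ n f ≤ 2 * ℓ))
theorem2 = 4 , z<s , λ G _≈?_ γ n 2≤n cyclic ℓ ℓ∣n f cyclotomic →
  let instance
        n≢0 : NonZero n
        n≢0 = >-nonZero (≤-trans (s≤s z≤n) 2≤n)
  in countDH²≤16ℓ²n G _≈?_ cyclic ℓ∣n cyclotomic , countDH≤2ℓ G _≈?_ cyclic ℓ∣n cyclotomic
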